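{- Let $\mathcal{S}=\{s_1,\ldots,s_n\}$ be a finite set of items, $\mathcal{L}=\{\ell_1,\ldots,\ell_k\}$ a set of qualitative levels totally ordered by $\ell_1\prec\cdots\prec\ell_k$, $w\colon\mathcal{S}\to\mathbb{N}$, $r\colon\mathcal{S}\to\mathcal{L}$, and $W\in\mathbb{N}$. Consider the following greedy algorithm ("greedy w.r.t. $r$"): sort the items $r$-lexicographically, i.e., in non-increasing order of level $r(s)$, and among items with the same level in non-decreasing order of weight; set $S^*=\emptyset$ and a residual capacity $c=W$; go through the items in this order and, whenever the current item $s$ satisfies $w(s)\le c$, add $s$ to $S^*$ and set $c\leftarrow c-w(s)$; return $S^*$. Then the returned set $S^*$ is efficient.
   Context: $\mathcal{S}(W)=\{S'\subseteq\mathcal{S}: w(S')\le W\}$, $w(S')=\sum_{s\in S'}w(s)$. A numerical representation with respect to $r$ is a function $v\colon\mathcal{L}\to\mathbb{Q}^+$ such that for all $s_1,s_2\in\mathcal{S}$: $r(s_1)\succ r(s_2)$ iff $v(r(s_1))>v(r(s_2))$, and $r(s_1)=r(s_2)$ iff $v(r(s_1))=v(r(s_2))$; $\mathcal{V}_r$ is the set of all such $v$. For $S\subseteq\mathcal{S}$, $g_i(S)=|\{s\in S: r(s)=\ell_i\}|$ and $v(S)=\sum_{i=1}^k v(\ell_i)g_i(S)$. For $S_1,S_2\in\mathcal{S}(W)$: $S_1\succeq S_2$ iff $v(S_1)\ge v(S_2)$ for all $v\in\mathcal{V}_r$; $S_1$ dominates $S_2$ ($S_1\succ S_2$) iff $S_1\succeq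 S_2$ and $v^*(S_1)>v^*(S_2)$ for some $v^*\in\mathcal{V}_r$. A set $S^*\in\mathcal{S}(W)$ is efficient if there is no $S\in\mathcal{S}(W)$ with $S\succ S^*$. -}

module Defs where

open import Data.Nat as ℕ using (ℕ; zero; suc; _∸_)
open import Data.Nat.Properties using (_≤?_)
open import Data.Integer using (+_)
open import Data.Rational as ℚ using (ℚ; 0ℚ; _/_)
open import Data.Fin as Fin using (Fin; _≟_)
open import Data.Fin.Subset using (Subset; ⊥; ⁅_⁆; _∪_; _∩_; ∣_∣; inside; outside)
open import Data.Vec using (Vec; tabulate; lookup; foldr)
import Data.Vec as Vec
open import Data.Bool using (if_then_else_)
open import Data.List using (List; []; _∷_)
open import Data.List.Relation.Unary.AllPairs using (AllPairs)
open import Data.Product using (_×_; Σ; ∃)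
open import Data.Sum using (_⊎_)
open import Function.Bundles using (_⇔_)
open import Relation.Nullary using (¬_; yes; no; does)
open import Relation.Binary.PropositionalEquality using (_≡_)

-- Items are Fin n, levels are Fin k with ℓ₁ ≺ ... ≺ ℓₖ given by the order on Fin k.
-- Subsets of items are Data.Fin.Subset (characteristic vectors).

module _ {n k : ℕ} (w : Fin n → ℕ) (r : Fin n → Fin k) where

  weight : Subset n → ℕ
  weight S = Vec.sum (tabulate λ s → if lookup S s then w s else 0)

  Feasible : ℕ → Subset n → Set
  Feasible W S = weight S ℕ.≤ W

  record NumRep (v : Fin k → ℚ) : Set where
    field
      positive : ∀ l → 0ℚ ℚ.< v l
      strict   : ∀ s₁ s₂ → (r s₂ Fin.< r s₁) ⇔ (v (r s₂) ℚ.< v (r s₁))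
      equal    : ∀ s₁ s₂ → (r s₁ ≡ r s₂) ⇔ (v (r s₁) ≡ v (r s₂))

  levelSet : Fin k → Subset n
  levelSet i = tabulate λ s → does (r s ≟ i)

  g : Fin k → Subset n → ℕ
  g i S = ∣ S ∩ levelSet i ∣

  value : (Fin k → ℚ) → Subset n → ℚ
  value v S = foldr _ ℚ._+_ 0ℚ (tabulate λ i → v i ℚ.* ((+ g i S) / 1))

  _⪰_ : Subset n → Subset n → Set
  S₁ ⪰ S₂ = ∀ v → NumRep v → value v S₂ ℚ.≤ value v S₁

  Dominates : Subset n → Subset n → Set
  Dominates S₁ S₂ = (S₁ ⪰ S₂) × Σ (Fin k → ℚ) λ v → NumRep v × (value v S₂ ℚ.< value v S₁)

  Efficient : ℕ → Subset n → Set
  Efficient W S* = Feasible W S* × (¬ Σ (Subset n) λ S → Feasible W S × Dominates S S*)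

  RLexBefore : Fin n → Fin n → Set
  RLexBefore a b = (r b Fin.< r a) ⊎ ((r a ≡ r b) × (w a ℕ.≤ w b))

  RLexSorted : List (Fin n) → Set
  RLexSorted = AllPairs RLexBefore

  greedy : ℕ → List (Fin n) → Subset n
  greedy c [] = ⊥
  greedy c (s ∷ ss) with w s ≤? c
  ... | yes _ = ⁅ s ⁆ ∪ greedy (c ∸ w s) ss
  ... | no _  = greedy c ss

module Submission where

-- Compare sets through their level-count vectors g(S) = (g₁(S), …, gₖ(S)),
-- ordered lexicographically from the top level ℓₖ downwards.
--
--  (1) The greedy set G is feasible, and g(S) ≤lex g(G) for every feasible S.
--      This is an exchange argument along the sorted scan.  When greedy takes
--      an item s that S does not contain, either S contains an item t of the
--      same level (no lighter than s, by the r-lexicographic order), and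
--      trading t for s keeps both the counts and feasibility of S, or S has
--      fewer items of level r(s) than G, while both have none above r(s).
--  (2) The representation v(ℓᵢ) = Bⁱ with B = n + 2 reads g(S) as a base-B
--      numeral with digits at most n < B, so g(S) <lex g(G) gives v(S) < v(G).
--  Thus a feasible S with S ⪰ G has g(S) = g(G), so v(S) = v(G) for every v,
--  and S cannot dominate G.

open import Defs
open import Data.Nat using (ℕ)
open import Data.Fin using (Fin)
open import Data.List using (List; allFin)
open import Data.List.Relation.Binary.Permutation.Propositional using (_↭_)

open import Data.Nat as ℕ using (zero; suc; _+_; _*_; _∸_; _^_; z≤n; s≤s)
import Data.Nat.Properties as NP
open import Data.Nat.ListAction using (sum)
open import Data.Nat.ListAction.Properties using (sum-↭)
import Data.Nat.Coprimality as Coprime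
open import Data.Integer as ℤ using () renaming (+_ to pos)
import Data.Integer.Properties as ℤP
open import Data.Rational as ℚ using (ℚ; 0ℚ; _/_; mkℚ)
import Data.Rational.Properties as ℚP
open import Data.Fin as F using (zero; suc; toℕ; _≟_)
import Data.Fin.Properties as FP
open import Data.Fin.Subset using (Subset; ⁅_⁆; _∪_; _∩_; ∣_∣)
open import Data.Fin.Subset.Properties using (∣p∣≤n)
open import Data.Bool using (Bool; true; false; _∧_; _∨_; not; if_then_else_)
open import Data.Vec as V using ([]; _∷_; tabulate; lookup)
import Data.Vec.Properties as VP
import Data.Bool.Properties as BP
open import Data.List as L using ([]; _∷_; map)
open import Data.List.Membership.Propositional using (_∈_)
open import Data.List.Relation.Unary.All as All using (All; []; _∷_)
open import Data.List.Relation.Unary.Any using (here; there)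
open import Data.List.Relation.Unary.AllPairs using ([]; _∷_)
open import Data.List.Relation.Unary.Unique.Propositional using (Unique)
open import Data.List.Relation.Unary.Unique.Propositional.Properties using (allFin⁺)
open import Data.List.Relation.Binary.Permutation.Propositional using (↭-sym; ↭⇒↭ₛ)
open import Data.List.Relation.Binary.Permutation.Propositional.Properties using (map⁺)
import Data.List.Relation.Binary.Permutation.Setoid.Properties as PermutationSetoid
open import Data.Product using (Σ; _×_; _,_)
open import Function.Bundles using (mk⇔)
open import Data.Sum using (_⊎_; inj₁; inj₂)
open import Data.Empty using (⊥-elim)
open import Function using (_∘_)
open import Relation.Binary using (tri<; tri≈; tri>)
open import Relation.Nullary using (¬_; Dec; yes; no; does)
open import Relation.Nullary.Decidable using (dec-true; dec-false)
open import Relation.Binary.PropositionalEquality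
  using (_≡_; _≢_; refl; sym; trans; cong; cong₂; subst; subst₂; setoid; module ≡-Reasoning)

toℚ : ℕ → ℚ
toℚ a = pos a / 1

toℚ-normal : ∀ a → toℚ a ≡ mkℚ (pos a) 0 (Coprime.sym (Coprime.1-coprimeTo a))
toℚ-normal a = ℚP.normalize-coprime (Coprime.sym (Coprime.1-coprimeTo a))

toℚ-+ : ∀ a b → toℚ a ℚ.+ toℚ b ≡ toℚ (a + b)
toℚ-+ a b rewrite toℚ-normal a | toℚ-normal b =
  trans (cong (_/ 1) (cong₂ ℤ._+_ (ℤP.*-identityʳ (pos a)) (ℤP.*-identityʳ (pos b))))
        (sym (cong (_/ 1) (ℤP.pos-+ a b)))

toℚ-* : ∀ a b → toℚ a ℚ.* toℚ b ≡ toℚ (a * b)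
toℚ-* a b rewrite toℚ-normal a | toℚ-normal b = cong (_/ 1) (sym (ℤP.pos-* a b))

toℚ-mono-< : ∀ {a b} → a ℕ.< b → toℚ a ℚ.< toℚ b
toℚ-mono-< {a} {b} a<b rewrite toℚ-normal a | toℚ-normal b =
  ℚ.*<* (subst₂ ℤ._<_ (sym (ℤP.*-identityʳ (pos a))) (sym (ℤP.*-identityʳ (pos b))) (ℤ.+<+ a<b))

-- A strictly monotone map ℕ → ℚ reflects the order and is injective; this
-- gives the "if" directions required of a numerical representation.
module StrictlyMonotone (φ : ℕ → ℚ) (mono : ∀ {x y} → x ℕ.< y → φ x ℚ.< φ y) where

  reflects-< : ∀ {x y} → φ x ℚ.< φ y → x ℕ.< y
  reflects-< {x} {y} φx<φy with NP.<-cmp x y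
  ... | tri< x<y _ _ = x<y
  ... | tri≈ _ refl _ = ⊥-elim (ℚP.<-irrefl refl φx<φy)
  ... | tri> _ _ y<x = ⊥-elim (ℚP.<-asym φx<φy (mono y<x))

  injective : ∀ {x y} → φ x ≡ φ y → x ≡ y
  injective {x} {y} φx≡φy with NP.<-cmp x y
  ... | tri< x<y _ _ = ⊥-elim (ℚP.<-irrefl φx≡φy (mono x<y))
  ... | tri≈ _ x≡y _ = x≡y
  ... | tri> _ _ y<x = ⊥-elim (ℚP.<-irrefl (sym φx≡φy) (mono y<x))

-- Lexicographic order on digit vectors a : Fin m → ℕ, most significant digit
-- at the top index: a <lex b if they agree above some j and a j < b j.

LexLt : ∀ {m} → (Fin m → ℕ) → (Fin m → ℕ) → Set
LexLt {m} a b = Σ (Fin m) λ j → (a j ℕ.< b j) × (∀ i → j F.< i → a i ≡ b i)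

LexLe : ∀ {m} → (Fin m → ℕ) → (Fin m → ℕ) → Set
LexLe a b = (∀ i → a i ≡ b i) ⊎ LexLt a b

LexLe-resp : ∀ {m} {a a′ b b′ : Fin m → ℕ} →
  (∀ i → a i ≡ a′ i) → (∀ i → b i ≡ b′ i) → LexLe a b → LexLe a′ b′
LexLe-resp a≡ b≡ (inj₁ a≡b) = inj₁ λ i → trans (sym (a≡ i)) (trans (a≡b i) (b≡ i))
LexLe-resp a≡ b≡ (inj₂ (j , aj<bj , above)) =
  inj₂ (j , subst₂ ℕ._<_ (a≡ j) (b≡ j) aj<bj ,
        λ i j<i → trans (sym (a≡ i)) (trans (above i j<i) (b≡ i)))

LexLe-+ : ∀ {m} {a b : Fin m → ℕ} (u : Fin m → ℕ) →
  LexLe a b → LexLe (λ i → u i + a i) (λ i → u i + b i)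
LexLe-+ u (inj₁ a≡b) = inj₁ λ i → cong (u i +_) (a≡b i)
LexLe-+ u (inj₂ (j , aj<bj , above)) =
  inj₂ (j , NP.+-monoʳ-< (u j) aj<bj , λ i j<i → cong (u i +_) (above i j<i))

dot : ∀ {m} → (Fin m → ℕ) → (Fin m → ℕ) → ℕ
dot {zero} f a = 0
dot {suc m} f a = f zero * a zero + dot (f ∘ suc) (a ∘ suc)

dot-scale : ∀ {m} c (f a : Fin m → ℕ) → dot (λ i → c * f i) a ≡ c * dot f a
dot-scale {zero} c f a = sym (NP.*-zeroʳ c)
dot-scale {suc m} c f a = begin
  c * f zero * a zero + dot (λ i → c * f (suc i)) (a ∘ suc)
    ≡⟨ cong₂ _+_ (NP.*-assoc c _ _) (dot-scale c (f ∘ suc) (a ∘ suc)) ⟩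
  c * (f zero * a zero) + c * dot (f ∘ suc) (a ∘ suc)
    ≡⟨ NP.*-distribˡ-+ c _ _ ⟨
  c * dot f a
    ∎
  where open ≡-Reasoning

dot-toℚ : ∀ {m} (f a : Fin m → ℕ) →
  V.foldr _ ℚ._+_ 0ℚ (tabulate λ i → toℚ (f i) ℚ.* toℚ (a i)) ≡ toℚ (dot f a)
dot-toℚ {zero} f a = refl
dot-toℚ {suc m} f a = trans (cong₂ ℚ._+_ (toℚ-* (f zero) (a zero)) (dot-toℚ (f ∘ suc) (a ∘ suc)))
                             (toℚ-+ (f zero * a zero) _)

module Numeral (B : ℕ) where

  -- the number with base-B digits a (a zero least significant)
  numeral : ∀ {m} → (Fin m → ℕ) → ℕ
  numeral {zero} a = 0
  numeral {suc m} a = a zero + B * numeral (a ∘ suc)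

  numeral-cong : ∀ {m} {a b : Fin m → ℕ} → (∀ i → a i ≡ b i) → numeral a ≡ numeral b
  numeral-cong {zero} _ = refl
  numeral-cong {suc m} a≡b = cong₂ (λ x y → x + B * y) (a≡b zero) (numeral-cong (a≡b ∘ suc))

  numeral-mono : ∀ {m} (a b : Fin m → ℕ) → (∀ i → a i ℕ.< B) → LexLt a b → numeral a ℕ.< numeral b
  numeral-mono {suc m} a b a<B (zero , a₀<b₀ , above) = begin-strict
    a zero + B * numeral (a ∘ suc)  <⟨ NP.+-monoˡ-< _ a₀<b₀ ⟩
    b zero + B * numeral (a ∘ suc)  ≡⟨ cong (λ y → b zero + B * y) (numeral-cong same-tail) ⟩
    b zero + B * numeral (b ∘ suc)  ∎
    where
    open NP.≤-Reasoning
    same-tail : ∀ i → a (suc i) ≡ b (suc i)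
    same-tail i = above (suc i) (s≤s z≤n)
  numeral-mono {suc m} a b a<B (suc j , aj<bj , above) = begin-strict
    a zero + B * numeral (a ∘ suc)  <⟨ NP.+-monoˡ-< _ (a<B zero) ⟩
    B + B * numeral (a ∘ suc)       ≡⟨ NP.*-suc B _ ⟨
    B * suc (numeral (a ∘ suc))     ≤⟨ NP.*-monoʳ-≤ B tail< ⟩
    B * numeral (b ∘ suc)           ≤⟨ NP.m≤n+m _ (b zero) ⟩
    b zero + B * numeral (b ∘ suc)  ∎
    where
    open NP.≤-Reasoning
    tail< : numeral (a ∘ suc) ℕ.< numeral (b ∘ suc)
    tail< = numeral-mono (a ∘ suc) (b ∘ suc) (a<B ∘ suc) (j , aj<bj , λ i j<i → above (suc i) (s≤s j<i))

  dot-powers : ∀ {m} (a : Fin m → ℕ) → dot (λ i → B ^ toℕ i) a ≡ numeral a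
  dot-powers {zero} a = refl
  dot-powers {suc m} a = cong₂ _+_ (NP.*-identityˡ (a zero))
    (trans (dot-scale B (λ i → B ^ toℕ i) (a ∘ suc)) (cong (B *_) (dot-powers (a ∘ suc))))

module _ {A : Set} where

  ΣL : List A → (A → ℕ) → ℕ
  ΣL xs f = sum (map f xs)

  ΣL-cong : ∀ {xs} {f h : A → ℕ} → All (λ x → f x ≡ h x) xs → ΣL xs f ≡ ΣL xs h
  ΣL-cong [] = refl
  ΣL-cong (fx≡hx ∷ rest) = cong₂ _+_ fx≡hx (ΣL-cong rest)

  ΣL-↭ : ∀ {xs ys} (f : A → ℕ) → xs ↭ ys → ΣL xs f ≡ ΣL ys f
  ΣL-↭ f xs↭ys = sum-↭ (map⁺ f xs↭ys)

  ΣL-update : ∀ {xs t} {f h : A → ℕ} → Unique xs → t ∈ xs →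
    All (λ x → x ≢ t → f x ≡ h x) xs → ΣL xs f + h t ≡ ΣL xs h + f t
  ΣL-update {x ∷ xs} {f = f} {h} (x∉xs ∷ _) (here refl) (_ ∷ agree) = begin
    f x + ΣL xs f + h x  ≡⟨ cong (λ σ → f x + σ + h x) same ⟩
    f x + ΣL xs h + h x  ≡⟨ NP.+-assoc (f x) _ _ ⟩
    f x + (ΣL xs h + h x) ≡⟨ NP.+-comm (f x) _ ⟩
    ΣL xs h + h x + f x  ≡⟨ cong (_+ f x) (NP.+-comm (ΣL xs h) (h x)) ⟩
    h x + ΣL xs h + f x  ∎
    where
    open ≡-Reasoning
    same : ΣL xs f ≡ ΣL xs h
    same = ΣL-cong (All.zipWith (λ (x≢y , agrees) → agrees (x≢y ∘ sym)) (x∉xs , agree))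
  ΣL-update {x ∷ xs} {t} {f} {h} (x∉xs ∷ u) (there t∈xs) (fx≡hx ∷ agree) = begin
    f x + ΣL xs f + h t    ≡⟨ NP.+-assoc (f x) _ _ ⟩
    f x + (ΣL xs f + h t)  ≡⟨ cong₂ _+_ (fx≡hx x≢t) (ΣL-update u t∈xs agree) ⟩
    h x + (ΣL xs h + f t)  ≡⟨ NP.+-assoc (h x) _ _ ⟨
    h x + ΣL xs h + f t    ∎
    where
    open ≡-Reasoning
    x≢t : x ≢ t
    x≢t = All.lookup x∉xs t∈xs

  part : (A → Bool) → (A → ℕ) → A → ℕ
  part sel a x = if sel x then a x else 0

  part-chosen : ∀ {x} sel (a : A → ℕ) → sel x ≡ true → part sel a x ≡ a x
  part-chosen sel a chosen rewrite chosen = refl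

  part-unchosen : ∀ {x} sel (a : A → ℕ) → sel x ≡ false → part sel a x ≡ 0
  part-unchosen sel a unchosen rewrite unchosen = refl

  Σsel : List A → (A → Bool) → (A → ℕ) → ℕ
  Σsel xs sel a = ΣL xs (part sel a)

  Σsel-cong : ∀ {xs sel sel′} (a : A → ℕ) →
    All (λ x → sel x ≡ sel′ x) xs → Σsel xs sel a ≡ Σsel xs sel′ a
  Σsel-cong a same = ΣL-cong (All.map (cong (λ b → if b then a _ else 0)) same)

  Σsel-chosen : ∀ {x} xs sel (a : A → ℕ) → sel x ≡ true → Σsel (x ∷ xs) sel a ≡ a x + Σsel xs sel a
  Σsel-chosen xs sel a chosen = cong (_+ Σsel xs sel a) (part-chosen sel a chosen)

  Σsel-unchosen : ∀ {x} xs sel (a : A → ℕ) → sel x ≡ false → Σsel (x ∷ xs) sel a ≡ Σsel xs sel a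
  Σsel-unchosen xs sel a unchosen = cong (_+ Σsel xs sel a) (part-unchosen sel a unchosen)

  Σsel-vanish : ∀ {xs} sel {a : A → ℕ} → All (λ x → a x ≡ 0) xs → Σsel xs sel a ≡ 0
  Σsel-vanish sel [] = refl
  Σsel-vanish sel {a} (_∷_ {x} ax≡0 rest) with sel x
  ... | true = cong₂ _+_ ax≡0 (Σsel-vanish sel rest)
  ... | false = Σsel-vanish sel rest

  ChosenNonzero : List A → (A → Bool) → (A → ℕ) → Set
  ChosenNonzero xs sel a = Σ A λ t → t ∈ xs × sel t ≡ true × a t ≢ 0

  ChosenNonzero-there : ∀ {x xs sel a} → ChosenNonzero xs sel a → ChosenNonzero (x ∷ xs) sel a
  ChosenNonzero-there (t , t∈xs , chosen , at≢0) = t , there t∈xs , chosen , at≢0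

  Σsel-witness : ∀ xs sel (a : A → ℕ) → Σsel xs sel a ≢ 0 → ChosenNonzero xs sel a
  Σsel-witness [] sel a nonzero = ⊥-elim (nonzero refl)
  Σsel-witness (x ∷ xs) sel a nonzero with sel x in chosen | a x in ax
  ... | true | suc _ = x , here refl , chosen , λ ax≡0 → NP.1+n≢0 (trans (sym ax) ax≡0)
  ... | true | zero = ChosenNonzero-there (Σsel-witness xs sel a nonzero)
  ... | false | _ = ChosenNonzero-there (Σsel-witness xs sel a nonzero)

lookup-⁅⁆-self : ∀ {m} (s : Fin m) → lookup ⁅ s ⁆ s ≡ true
lookup-⁅⁆-self zero = refl
lookup-⁅⁆-self (suc s) = lookup-⁅⁆-self s

lookup-⁅⁆-other : ∀ {m} {s t : Fin m} → t ≢ s → lookup ⁅ s ⁆ t ≡ false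
lookup-⁅⁆-other {s = zero} {zero} t≢s = ⊥-elim (t≢s refl)
lookup-⁅⁆-other {s = zero} {suc t} _ = VP.lookup-replicate t false
lookup-⁅⁆-other {s = suc s} {zero} _ = refl
lookup-⁅⁆-other {s = suc s} {suc t} t≢s = lookup-⁅⁆-other (t≢s ∘ cong suc)

lookup-insert-self : ∀ {m} (s : Fin m) p → lookup (⁅ s ⁆ ∪ p) s ≡ true
lookup-insert-self s p = trans (VP.lookup-zipWith _∨_ s ⁅ s ⁆ p) (cong (_∨ lookup p s) (lookup-⁅⁆-self s))

lookup-insert-other : ∀ {m} {s t : Fin m} p → t ≢ s → lookup (⁅ s ⁆ ∪ p) t ≡ lookup p t
lookup-insert-other {s = s} {t} p t≢s =
  trans (VP.lookup-zipWith _∨_ t ⁅ s ⁆ p) (cong (_∨ lookup p t) (lookup-⁅⁆-other t≢s))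

exchange : ∀ {m} → Fin m → Fin m → (Fin m → Bool) → Fin m → Bool
exchange s t sel x = does (x ≟ s) ∨ (sel x ∧ not (does (x ≟ t)))

module _ {m} {s t : Fin m} (sel : Fin m → Bool) where

  exchange-takes : exchange s t sel s ≡ true
  exchange-takes = cong (_∨ (sel s ∧ not (does (s ≟ t)))) (dec-true (s ≟ s) refl)

  exchange-drops : t ≢ s → exchange s t sel t ≡ false
  exchange-drops t≢s rewrite dec-false (t ≟ s) t≢s | dec-true (t ≟ t) refl = BP.∧-zeroʳ (sel t)

  exchange-keeps : ∀ {x} → x ≢ s → x ≢ t → exchange s t sel x ≡ sel x
  exchange-keeps {x} x≢s x≢t rewrite dec-false (x ≟ s) x≢s | dec-false (x ≟ t) x≢t =
    BP.∧-identityʳ (sel x)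

  Σsel-exchange : ∀ {xs} (a : Fin m → ℕ) → All (s ≢_) xs → Unique xs → t ∈ xs →
    sel s ≡ false → sel t ≡ true →
    Σsel (s ∷ xs) (exchange s t sel) a + a t ≡ Σsel (s ∷ xs) sel a + a s
  Σsel-exchange {xs} a s∉xs unique t∈xs unchosen-s chosen-t = begin
    Σsel (s ∷ xs) sel′ a + a t     ≡⟨ cong (_+ a t) (Σsel-chosen xs sel′ a exchange-takes) ⟩
    a s + Σsel xs sel′ a + a t     ≡⟨ NP.+-assoc (a s) _ _ ⟩
    a s + (Σsel xs sel′ a + a t)   ≡⟨ cong (a s +_) traded ⟩
    a s + Σsel xs sel a            ≡⟨ NP.+-comm (a s) _ ⟩
    Σsel xs sel a + a s            ≡⟨ cong (_+ a s) (Σsel-unchosen xs sel a unchosen-s) ⟨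
    Σsel (s ∷ xs) sel a + a s      ∎
    where
    open ≡-Reasoning
    sel′ = exchange s t sel
    t≢s : t ≢ s
    t≢s = (All.lookup s∉xs t∈xs) ∘ sym
    agree : All (λ x → x ≢ t → part sel′ a x ≡ part sel a x) xs
    agree = All.map (λ s≢x x≢t → cong (λ b → if b then a _ else 0) (exchange-keeps (s≢x ∘ sym) x≢t))
                    s∉xs
    traded : Σsel xs sel′ a + a t ≡ Σsel xs sel a
    traded = begin
      Σsel xs sel′ a + a t            ≡⟨ cong (Σsel xs sel′ a +_) (part-chosen sel a chosen-t) ⟨
      Σsel xs sel′ a + part sel a t   ≡⟨ ΣL-update unique t∈xs agree ⟩
      Σsel xs sel a + part sel′ a t   ≡⟨ cong (Σsel xs sel a +_) (part-unchosen sel′ a (exchange-drops t≢s)) ⟩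
      Σsel xs sel a + 0               ≡⟨ NP.+-identityʳ _ ⟩
      Σsel xs sel a                   ∎

module Greedy {n k : ℕ} (w : Fin n → ℕ) (r : Fin n → Fin k) where

  picked : ℕ → List (Fin n) → Fin n → Bool
  picked c xs = lookup (greedy w r c xs)

  picked-absent : ∀ c xs {t} → All (t ≢_) xs → picked c xs t ≡ false
  picked-absent c [] {t} _ = VP.lookup-replicate t false
  picked-absent c (x ∷ xs) (t≢x ∷ t∉xs) with w x NP.≤? c
  ... | yes _ = trans (lookup-insert-other (greedy w r (c ∸ w x) xs) t≢x) (picked-absent (c ∸ w x) xs t∉xs)
  ... | no _ = picked-absent c xs t∉xs

  Σsel-take : ∀ c s xs → All (s ≢_) xs → w s ℕ.≤ c → ∀ a →
    Σsel (s ∷ xs) (picked c (s ∷ xs)) a ≡ a s + Σsel xs (picked (c ∸ w s) xs) a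
  Σsel-take c s xs s∉xs ws≤c a with w s NP.≤? c
  ... | no ws≰c = ⊥-elim (ws≰c ws≤c)
  ... | yes _ = trans (Σsel-chosen xs _ a (lookup-insert-self s rest)) (cong (a s +_) (Σsel-cong a same-rest))
    where
    rest = greedy w r (c ∸ w s) xs
    same-rest : All (λ x → lookup (⁅ s ⁆ ∪ rest) x ≡ lookup rest x) xs
    same-rest = All.map (λ s≢x → lookup-insert-other rest (s≢x ∘ sym)) s∉xs

  Σsel-skip : ∀ c s xs → All (s ≢_) xs → ¬ w s ℕ.≤ c → ∀ a →
    Σsel (s ∷ xs) (picked c (s ∷ xs)) a ≡ Σsel xs (picked c xs) a
  Σsel-skip c s xs s∉xs ws≰c a with w s NP.≤? c
  ... | yes ws≤c = ⊥-elim (ws≰c ws≤c)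
  ... | no _ = Σsel-unchosen xs (picked c xs) a (picked-absent c xs s∉xs)

  greedy-fits : ∀ xs → Unique xs → ∀ c → Σsel xs (picked c xs) w ℕ.≤ c
  greedy-fits [] _ c = z≤n
  greedy-fits (s ∷ xs) (s∉xs ∷ unique) c = byCapacity (w s NP.≤? c)
    where
    open NP.≤-Reasoning
    byCapacity : Dec (w s ℕ.≤ c) → Σsel (s ∷ xs) (picked c (s ∷ xs)) w ℕ.≤ c
    byCapacity (yes ws≤c) = begin
      Σsel (s ∷ xs) (picked c (s ∷ xs)) w         ≡⟨ Σsel-take c s xs s∉xs ws≤c w ⟩
      w s + Σsel xs (picked (c ∸ w s) xs) w       ≤⟨ NP.+-monoʳ-≤ (w s) (greedy-fits xs unique (c ∸ w s)) ⟩
      w s + (c ∸ w s)                             ≡⟨ NP.m+[n∸m]≡n ws≤c ⟩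
      c                                           ∎
    byCapacity (no ws≰c) = begin
      Σsel (s ∷ xs) (picked c (s ∷ xs)) w  ≡⟨ Σsel-skip c s xs s∉xs ws≰c w ⟩
      Σsel xs (picked c xs) w              ≤⟨ greedy-fits xs unique c ⟩
      c                                    ∎

  atLevel : Fin k → Fin n → ℕ
  atLevel i x = if does (r x ≟ i) then 1 else 0

  atLevel-own : ∀ x → atLevel (r x) x ≡ 1
  atLevel-own x = cong (λ b → if b then 1 else 0) (dec-true (r x ≟ r x) refl)

  atLevel-cong : ∀ i {x y} → r x ≡ r y → atLevel i x ≡ atLevel i y
  atLevel-cong i rx≡ry = cong (λ l → if does (l ≟ i) then 1 else 0) rx≡ry

  atLevel-nonzero : ∀ {i x} → atLevel i x ≢ 0 → r x ≡ i
  atLevel-nonzero {i} {x} nonzero with r x ≟ i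
  ... | yes rx≡i = rx≡i
  ... | no _ = ⊥-elim (nonzero refl)

  count : List (Fin n) → (Fin n → Bool) → Fin k → ℕ
  count xs sel i = Σsel xs sel (atLevel i)

  count-above : ∀ {xs} {j : Fin k} → All (λ x → r x F.≤ j) xs →
    ∀ sel i → j F.< i → count xs sel i ≡ 0
  count-above {j = j} below sel i j<i = Σsel-vanish sel (All.map notAtLevel below)
    where
    notAtLevel : ∀ {x} → r x F.≤ j → atLevel i x ≡ 0
    notAtLevel {x} rx≤j with r x ≟ i
    ... | yes refl = ⊥-elim (NP.<⇒≱ j<i rx≤j)
    ... | no _ = refl

  LexMaximal : List (Fin n) → Set
  LexMaximal xs = ∀ c sel → Σsel xs sel w ℕ.≤ c → LexLe (count xs sel) (count xs (picked c xs))

  module Step {s xs} (s∉xs : All (s ≢_) xs) (unique : Unique xs)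
              (s-first : All (RLexBefore w r s) xs) (ih : LexMaximal xs) where

    Fits : ℕ → (Fin n → Bool) → Set
    Fits c sel = Σsel (s ∷ xs) sel w ℕ.≤ c

    Wins : ℕ → (Fin n → Bool) → Set
    Wins c sel = LexLe (count (s ∷ xs) sel) (count (s ∷ xs) (picked c (s ∷ xs)))

    skip : ∀ {c} → ¬ w s ℕ.≤ c → ∀ sel → Fits c sel → Wins c sel
    skip {c} ws≰c sel fits = bySelection (sel s) refl
      where
      bySelection : ∀ b → sel s ≡ b → Wins c sel
      bySelection true chosen =
        ⊥-elim (ws≰c (NP.m+n≤o⇒m≤o (w s) (subst (ℕ._≤ c) (Σsel-chosen xs sel w chosen) fits)))
      bySelection false unchosen =
        LexLe-resp (λ i → sym (Σsel-unchosen xs sel (atLevel i) unchosen))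
                   (λ i → sym (Σsel-skip c s xs s∉xs ws≰c (atLevel i)))
                   (ih c sel (subst (ℕ._≤ c) (Σsel-unchosen xs sel w unchosen) fits))

    take-chosen : ∀ {c} → w s ℕ.≤ c → ∀ sel → sel s ≡ true → Fits c sel → Wins c sel
    take-chosen {c} ws≤c sel chosen fits =
      LexLe-resp (λ i → sym (Σsel-chosen xs sel (atLevel i) chosen))
                 (λ i → sym (Σsel-take c s xs s∉xs ws≤c (atLevel i)))
                 (LexLe-+ (λ i → atLevel i s) (ih (c ∸ w s) sel rest-fits))
      where
      rest-fits : Σsel xs sel w ℕ.≤ c ∸ w s
      rest-fits = NP.m+n≤o⇒m≤o∸n _ (begin
        Σsel xs sel w + w s  ≡⟨ NP.+-comm _ (w s) ⟩
        w s + Σsel xs sel w  ≡⟨ Σsel-chosen xs sel w chosen ⟨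
        Σsel (s ∷ xs) sel w  ≤⟨ fits ⟩
        c                    ∎)
        where open NP.≤-Reasoning

    -- the selection skips s but contains an item t of the same level; it may
    -- trade t for the (no heavier) item s
    take-by-exchange : ∀ {c t} → w s ℕ.≤ c → ∀ sel → sel s ≡ false →
      t ∈ xs → sel t ≡ true → r t ≡ r s → Fits c sel → Wins c sel
    take-by-exchange {c} {t} ws≤c sel unchosen t∈xs chosen-t same-level fits =
      LexLe-resp same-counts (λ _ → refl)
                 (take-chosen ws≤c traded (exchange-takes sel) (NP.≤-trans lighter fits))
      where
      traded = exchange s t sel
      trade : ∀ a → Σsel (s ∷ xs) traded a + a t ≡ Σsel (s ∷ xs) sel a + a s
      trade a = Σsel-exchange sel a s∉xs unique t∈xs unchosen chosen-t
      same-counts : ∀ i → count (s ∷ xs) traded i ≡ count (s ∷ xs) sel i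
      same-counts i = NP.+-cancelʳ-≡ (atLevel i t) _ _ (begin
        count (s ∷ xs) traded i + atLevel i t  ≡⟨ trade (atLevel i) ⟩
        count (s ∷ xs) sel i + atLevel i s     ≡⟨ cong (count (s ∷ xs) sel i +_) (atLevel-cong i same-level) ⟨
        count (s ∷ xs) sel i + atLevel i t     ∎)
        where open ≡-Reasoning
      ws≤wt : w s ℕ.≤ w t
      ws≤wt with All.lookup s-first t∈xs
      ... | inj₁ rt<rs = ⊥-elim (NP.<-irrefl (cong toℕ same-level) rt<rs)
      ... | inj₂ (_ , ws≤wt) = ws≤wt
      lighter : Σsel (s ∷ xs) traded w ℕ.≤ Σsel (s ∷ xs) sel w
      lighter = NP.+-cancelʳ-≤ (w t) _ _ (begin
        Σsel (s ∷ xs) traded w + w t  ≡⟨ trade w ⟩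
        Σsel (s ∷ xs) sel w + w s     ≤⟨ NP.+-monoʳ-≤ (Σsel (s ∷ xs) sel w) ws≤wt ⟩
        Σsel (s ∷ xs) sel w + w t     ∎)
        where open NP.≤-Reasoning

    -- the selection has no item at level r s, where the scan has s, and
    -- neither has anything above r s
    take-strict : ∀ {c} → w s ℕ.≤ c → ∀ sel → sel s ≡ false →
      count xs sel (r s) ≡ 0 → Wins c sel
    take-strict {c} ws≤c sel unchosen none = inj₂ (r s , fewer , equal-above)
      where
      open NP.≤-Reasoning
      rest = count xs (picked (c ∸ w s) xs) (r s)
      fewer : count (s ∷ xs) sel (r s) ℕ.< count (s ∷ xs) (picked c (s ∷ xs)) (r s)
      fewer = begin-strict
        count (s ∷ xs) sel (r s)                  ≡⟨ Σsel-unchosen xs sel (atLevel (r s)) unchosen ⟩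
        count xs sel (r s)                        ≡⟨ none ⟩
        0                                         <⟨ s≤s z≤n ⟩
        1 + rest                                  ≡⟨ cong (_+ rest) (atLevel-own s) ⟨
        atLevel (r s) s + rest                    ≡⟨ Σsel-take c s xs s∉xs ws≤c (atLevel (r s)) ⟨
        count (s ∷ xs) (picked c (s ∷ xs)) (r s)  ∎
      levels-below : All (λ x → r x F.≤ r s) (s ∷ xs)
      levels-below = NP.≤-refl ∷ All.map below s-first
        where
        below : ∀ {x} → RLexBefore w r s x → r x F.≤ r s
        below (inj₁ rx<rs) = NP.<⇒≤ rx<rs
        below (inj₂ (rs≡rx , _)) = NP.≤-reflexive (cong toℕ (sym rs≡rx))
      equal-above : ∀ i → r s F.< i → count (s ∷ xs) sel i ≡ count (s ∷ xs) (picked c (s ∷ xs)) i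
      equal-above i rs<i = trans (count-above levels-below sel i rs<i)
                                 (sym (count-above levels-below (picked c (s ∷ xs)) i rs<i))

    step : LexMaximal (s ∷ xs)
    step c sel fits = byCapacity (w s NP.≤? c)
      where
      byCapacity : Dec (w s ℕ.≤ c) → Wins c sel
      byCapacity (no ws≰c) = skip ws≰c sel fits
      byCapacity (yes ws≤c) = bySelection (sel s) refl
        where
        bySelection : ∀ b → sel s ≡ b → Wins c sel
        bySelection true chosen = take-chosen ws≤c sel chosen fits
        bySelection false unchosen with count xs sel (r s) in count-rs
        ... | zero = take-strict ws≤c sel unchosen count-rs
        ... | suc _ with Σsel-witness xs sel (atLevel (r s)) (NP.1+n≢0 ∘ trans (sym count-rs))
        ...   | t , t∈xs , chosen-t , t-at-rs =
                take-by-exchange ws≤c sel unchosen t∈xs chosen-t (atLevel-nonzero t-at-rs) fits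

  greedy-lexmax : ∀ xs → Unique xs → RLexSorted w r xs → LexMaximal xs
  greedy-lexmax [] _ _ c sel _ = inj₁ λ _ → refl
  greedy-lexmax (s ∷ xs) (s∉xs ∷ unique) (s-first ∷ sorted) =
    Step.step s∉xs unique s-first (greedy-lexmax xs unique sorted)

card-as-sum : ∀ {m} (p : Subset m) → ∣ p ∣ ≡ V.sum (tabulate λ x → if lookup p x then 1 else 0)
card-as-sum [] = refl
card-as-sum (true ∷ p) = cong suc (card-as-sum p)
card-as-sum (false ∷ p) = card-as-sum p

sum-tabulate : ∀ {A : Set} {m} (e : Fin m → A) (f : A → ℕ) →
  V.sum (tabulate (f ∘ e)) ≡ ΣL (L.tabulate e) f
sum-tabulate {m = zero} e f = refl
sum-tabulate {m = suc m} e f = cong (f (e zero) +_) (sum-tabulate (e ∘ suc) f)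

module Enumeration {n k : ℕ} (w : Fin n → ℕ) (r : Fin n → Fin k)
                   {order : List (Fin n)} (perm : order ↭ allFin n) where
  open Greedy w r using (atLevel; count)

  subset-sum : ∀ S a → V.sum (tabulate (part (lookup S) a)) ≡ Σsel order (lookup S) a
  subset-sum S a = trans (sum-tabulate (λ x → x) (part (lookup S) a)) (sym (ΣL-↭ (part (lookup S) a) perm))

  weight-along : ∀ S → weight w r S ≡ Σsel order (lookup S) w
  weight-along S = subset-sum S w

  g-along : ∀ i S → g w r i S ≡ count order (lookup S) i
  g-along i S = begin
    ∣ S ∩ levelSet w r i ∣                                                  ≡⟨ card-as-sum (S ∩ levelSet w r i) ⟩
    V.sum (tabulate λ x → if lookup (S ∩ levelSet w r i) x then 1 else 0)  ≡⟨ cong V.sum (VP.tabulate-cong member) ⟩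
    V.sum (tabulate (part (lookup S) (atLevel i)))                          ≡⟨ subset-sum S (atLevel i) ⟩
    count order (lookup S) i                                                ∎
    where
    open ≡-Reasoning
    member : ∀ x → (if lookup (S ∩ levelSet w r i) x then 1 else 0) ≡ part (lookup S) (atLevel i) x
    member x rewrite VP.lookup-zipWith _∧_ x S (levelSet w r i)
                   | VP.lookup∘tabulate (λ y → does (r y ≟ i)) x with lookup S x
    ... | true = refl
    ... | false = refl

module Representation {n k : ℕ} (w : Fin n → ℕ) (r : Fin n → Fin k) where

  levels : Subset n → Fin k → ℕ
  levels S i = g w r i S

  value-cong : ∀ v S T → (∀ i → levels S i ≡ levels T i) → value w r v S ≡ value w r v T
  value-cong v S T same =
    cong (V.foldr _ ℚ._+_ 0ℚ) (VP.tabulate-cong λ i → cong (λ x → v i ℚ.* (pos x / 1)) (same i))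

  base : ℕ
  base = 2 + n

  powers : Fin k → ℚ
  powers i = toℚ (base ^ toℕ i)

  powers-mono : ∀ {x y} → x ℕ.< y → toℚ (base ^ x) ℚ.< toℚ (base ^ y)
  powers-mono = toℚ-mono-< ∘ NP.^-monoʳ-< base (s≤s (s≤s z≤n))

  powers-rep : NumRep w r powers
  powers-rep = record
    { positive = λ i → toℚ-mono-< (NP.m^n>0 base (toℕ i))
    ; strict = λ _ _ → mk⇔ powers-mono reflects-<
    ; equal = λ _ _ → mk⇔ (cong powers) (FP.toℕ-injective ∘ injective)
    }
    where open StrictlyMonotone (λ x → toℚ (base ^ x)) powers-mono

  -- under powers, v(S) is the base-(n+2) numeral with digits gᵢ(S) ≤ n
  value-powers : ∀ S → value w r powers S ≡ toℚ (Numeral.numeral base (levels S))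
  value-powers S =
    trans (dot-toℚ (λ i → base ^ toℕ i) (levels S)) (cong toℚ (Numeral.dot-powers base (levels S)))

  levels-digit : ∀ S i → levels S i ℕ.< base
  levels-digit S i = s≤s (NP.m≤n⇒m≤1+n (∣p∣≤n (S ∩ levelSet w r i)))

  powers-separate : ∀ S T → LexLt (levels S) (levels T) → value w r powers S ℚ.< value w r powers T
  powers-separate S T S<T = subst₂ ℚ._<_ (sym (value-powers S)) (sym (value-powers T))
    (toℚ-mono-< (Numeral.numeral-mono base (levels S) (levels T) (levels-digit S) S<T))

  lexmax⇒undominated : ∀ W G → (∀ S → Feasible w r W S → LexLe (levels S) (levels G)) →
    ¬ Σ (Subset n) λ S → Feasible w r W S × Dominates w r S G
  lexmax⇒undominated W G lexmax (S , S-fits , S⪰G , v , _ , G<S) with lexmax S S-fits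
  ... | inj₁ same = ℚP.<-irrefl (sym (value-cong v S G same)) G<S
  ... | inj₂ S<G = ℚP.<-irrefl refl (ℚP.<-≤-trans (powers-separate S G S<G) (S⪰G powers powers-rep))

mainTheorem3 : (n k : ℕ) (w : Fin n → ℕ) (r : Fin n → Fin k) (W : ℕ)
    (order : List (Fin n)) → order ↭ allFin n → RLexSorted w r order →
    Efficient w r W (greedy w r W order)
mainTheorem3 n k w r W order perm sorted = G-fits , lexmax⇒undominated W G G-lexmax
  where
  open Greedy w r
  open Enumeration w r perm
  open Representation w r
  G = greedy w r W order
  unique : Unique order
  unique = PermutationSetoid.Unique-resp-↭ (setoid (Fin n)) (↭⇒↭ₛ (↭-sym perm)) (allFin⁺ n)
  G-fits : Feasible w r W G
  G-fits = subst (ℕ._≤ W) (sym (weight-along G)) (greedy-fits order unique W)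
  G-lexmax : ∀ S → Feasible w r W S → LexLe (levels S) (levels G)
  G-lexmax S S-fits = LexLe-resp (λ i → sym (g-along i S)) (λ i → sym (g-along i G))
    (greedy-lexmax order unique sorted W (lookup S) (subst (ℕ._≤ W) (weight-along S) S-fits))
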